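{- Let $k\ge2$ and $n=p_1\cdots p_k$ with $p_1<\cdots<p_k$ odd primes. If $p_2>(k-1)(2p_1-3)$, then $\delta^-(n)\ge\frac12\frac{n}{p_1}$, where $\delta^-(n)=2\frac{n}{p_1}-\psi(n)$.
   Context: $\psi(n)=n-\varphi(n)$ is the degree of the $n$-th inverse cyclotomic polynomial, $\varphi$ being Euler's totient. -}

module Defs where

open import Data.Nat using (ℕ; suc; _∸_; _*_; _≤_; s≤s; z≤n; NonZero)
open import Data.Nat.DivMod using (_/_)
open import Data.Nat.GCD using (gcd)
open import Data.Nat.Properties using (_≟_; ≤-trans)
open import Data.Fin using (Fin; fromℕ<)
open import Data.List using (List; length; filter; map; upTo)
open import Data.Integer as ℤ using (ℤ; +_)

φ : ℕ → ℕ
φ n = length (filter (λ m → gcd m n ≟ 1) (map suc (upTo n)))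

-- ψ(n) = n - φ(n), the degree of the n-th inverse cyclotomic polynomial
ψ : ℕ → ℕ
ψ n = n ∸ φ n

-- δ⁻(n) = 2 n/p₁ - ψ(n)  (an integer, possibly negative in general)
δ⁻ : (n p₁ : ℕ) → .{{NonZero p₁}} → ℤ
δ⁻ n p₁ = (+ (2 * (n / p₁))) ℤ.- (+ ψ n)

prodF : ∀ {k} → (Fin k → ℕ) → ℕ
prodF {ℕ.zero} p = 1
prodF {suc k} p = p Fin.zero * prodF (λ i → p (Fin.suc i))

-- the (0-based) indices of p₁ and p₂ when k ≥ 2
i₁ : ∀ {k} → 2 ≤ k → Fin k
i₁ hk = fromℕ< (≤-trans (s≤s z≤n) hk)

i₂ : ∀ {k} → 2 ≤ k → Fin k
i₂ hk = fromℕ< hk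

-- Write n = p₁ M with M = p₂ ⋯ p_k and F = (p₂ − 1) ⋯ (p_k − 1). Then φ(n) = (p₁ − 1) F, and
-- 2 δ⁻(n) ≥ M amounts to a M ≤ (a + 1) F for a = 2 p₁ − 3, i.e. ∏ p_i / (p_i − 1) ≤ 1 + 1/a over
-- i ≥ 2. For k = 2 this is a < p₂. Otherwise (q / (q − 1))² ≤ (y + 4) / y whenever y + 3 ≤ 2 q, and
-- since odd primes are at least 2 apart these bounds telescope, starting from y = 2 p₂ − 3, to
-- (M / F)² ≤ (y + 4 (k − 1)) / y; the hypothesis (k − 1) a < p₂ makes this at most ((a + 1) / a)².

module Submission where

open import Data.Fin as Fin using (Fin)
import Data.Fin.Properties as Finₚ
open import Data.Integer as ℤ using (+_; +≤+)
import Data.Integer.Properties as ℤₚ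
open import Data.List using (length; filter; applyUpTo)
open import Data.List.Properties using (map-upTo)
open import Data.Nat
open import Data.Nat.Coprimality as Coprime using (Coprime; coprime-divisor; coprime-+; gcd≡1⇒coprime; coprime⇒gcd≡1)
open import Data.Nat.DivMod using (_/_; m*n/n≡m)
open import Data.Nat.Divisibility
open import Data.Nat.GCD using (gcd)
open import Data.Nat.Primality using (Prime; prime⇒nonZero; prime⇒nonTrivial; prime⇒irreducible)
open import Data.Nat.Properties
open import Data.Nat.Tactic.RingSolver using (solve-∀)
open import Data.Product using (_,_)
open import Data.Sum using (_⊎_; inj₁; inj₂)
open import Data.Vec.Functional using (head; tail)
open import Function using (_∘_)
open import Function.Definitions using (Injective)
open import Relation.Binary using (tri<; tri≈; tri>)
open import Relation.Binary.PropositionalEquality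
open import Relation.Nullary using (¬_; Dec; yes; no; contradiction)

open import Defs

private variable
  P Q : Set
  m n o p : ℕ

𝟙 : Dec P → ℕ
𝟙 (yes _) = 1
𝟙 (no _)  = 0

𝟙-cong : (P? : Dec P) (Q? : Dec Q) → (P → Q) → (Q → P) → 𝟙 P? ≡ 𝟙 Q?
𝟙-cong (yes _) (yes _) _   _   = refl
𝟙-cong (yes x) (no ¬y) P⇒Q _   = contradiction (P⇒Q x) ¬y
𝟙-cong (no ¬x) (yes y) _   Q⇒P = contradiction (Q⇒P y) ¬x
𝟙-cong (no _)  (no _)  _   _   = refl

𝟙-yes : (P? : Dec P) → P → 𝟙 P? ≡ 1
𝟙-yes (yes _) _ = refl
𝟙-yes (no ¬x) x = contradiction x ¬x

𝟙-no : (P? : Dec P) → ¬ P → 𝟙 P? ≡ 0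
𝟙-no (yes x) ¬x = contradiction x ¬x
𝟙-no (no _)  _  = refl

∑< : ℕ → (ℕ → ℕ) → ℕ
∑< zero    f = 0
∑< (suc n) f = f 0 + ∑< n (f ∘ suc)

∑<-cong : ∀ n {f g : ℕ → ℕ} → (∀ {u} → u < n → f u ≡ g u) → ∑< n f ≡ ∑< n g
∑<-cong zero    f≗g = refl
∑<-cong (suc n) f≗g = cong₂ _+_ (f≗g z<s) (∑<-cong n (f≗g ∘ s<s))

∑<-zero : ∀ n (f : ℕ → ℕ) → (∀ {u} → u < n → f u ≡ 0) → ∑< n f ≡ 0
∑<-zero zero    f f≡0 = refl
∑<-zero (suc n) f f≡0 = cong₂ _+_ (f≡0 z<s) (∑<-zero n (f ∘ suc) (f≡0 ∘ s<s))

∑<-suc : ∀ n (f : ℕ → ℕ) → ∑< (suc n) f ≡ ∑< n f + f n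
∑<-suc zero    f = +-comm (f 0) 0
∑<-suc (suc n) f = trans (cong (_+_ (f 0)) (∑<-suc n (f ∘ suc))) (sym (+-assoc (f 0) _ _))

∑<-+ : ∀ m n (f : ℕ → ℕ) → ∑< (m + n) f ≡ ∑< m f + ∑< n (f ∘ _+_ m)
∑<-+ zero    n f = refl
∑<-+ (suc m) n f = trans (cong (_+_ (f 0)) (∑<-+ m n (f ∘ suc))) (sym (+-assoc (f 0) _ _))

∑<-distrib : ∀ n (f g : ℕ → ℕ) → ∑< n (λ u → f u + g u) ≡ ∑< n f + ∑< n g
∑<-distrib zero    f g = refl
∑<-distrib (suc n) f g = trans (cong (_+_ (f 0 + g 0)) (∑<-distrib n (f ∘ suc) (g ∘ suc)))
                               (+-comm-middle (f 0) (g 0) _ _)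
  where
  +-comm-middle : ∀ a b c d → a + b + (c + d) ≡ a + c + (b + d)
  +-comm-middle = solve-∀

∑<-periodic : ∀ m (f : ℕ → ℕ) → (∀ u → f (m + u) ≡ f u) → ∀ v → ∑< (v * m) f ≡ v * ∑< m f
∑<-periodic m f per zero    = refl
∑<-periodic m f per (suc v) = trans (∑<-+ m (v * m) f)
  (cong (_+_ (∑< m f)) (trans (∑<-cong (v * m) (λ {u} _ → per u)) (∑<-periodic m f per v)))

∑<-first-multiple : ∀ p .{{_ : NonZero p}} (f : ℕ → ℕ) →
  ∑< p (λ u → f (suc u) * 𝟙 (p ∣? suc u)) ≡ f p
∑<-first-multiple (suc r) f = begin
  ∑< (suc r) g
    ≡⟨ ∑<-suc r g ⟩
  ∑< r g + f (suc r) * 𝟙 (suc r ∣? suc r)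
    ≡⟨ cong₂ _+_ (∑<-zero r g below-p) (cong (f (suc r) *_) (𝟙-yes _ ∣-refl)) ⟩
  f (suc r) * 1
    ≡⟨ *-identityʳ (f (suc r)) ⟩
  f (suc r) ∎
  where
  open ≡-Reasoning
  g = λ u → f (suc u) * 𝟙 (suc r ∣? suc u)
  below-p : ∀ {u} → u < r → g u ≡ 0
  below-p {u} u<r = trans (cong (f (suc u) *_) (𝟙-no _ (λ p∣1+u → <⇒≱ (s<s u<r) (∣⇒≤ p∣1+u))))
                          (*-zeroʳ (f (suc u)))

∑<-multiples : ∀ p .{{_ : NonZero p}} (f : ℕ → ℕ) m →
  ∑< (m * p) (λ u → f (suc u) * 𝟙 (p ∣? suc u)) ≡ ∑< m (λ w → f (p * suc w))
∑<-multiples p f zero    = refl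
∑<-multiples p f (suc m) = begin
  ∑< (p + m * p) g
    ≡⟨ ∑<-+ p (m * p) g ⟩
  ∑< p g + ∑< (m * p) (g ∘ _+_ p)
    ≡⟨ cong₂ _+_ (∑<-first-multiple p f) (∑<-cong (m * p) shift) ⟩
  f p + ∑< (m * p) (λ u → f (p + suc u) * 𝟙 (p ∣? suc u))
    ≡⟨ cong₂ _+_ (cong f (sym (*-identityʳ p))) (∑<-multiples p (f ∘ _+_ p) m) ⟩
  f (p * 1) + ∑< m (λ w → f (p + p * suc w))
    ≡⟨ cong (_+_ (f (p * 1))) (∑<-cong m (λ {w} _ → cong f (sym (*-suc p (suc w))))) ⟩
  ∑< (suc m) (λ w → f (p * suc w)) ∎
  where
  open ≡-Reasoning
  g = λ u → f (suc u) * 𝟙 (p ∣? suc u)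
  shift : ∀ {u} → u < m * p → g (p + u) ≡ f (p + suc u) * 𝟙 (p ∣? suc u)
  shift {u} _ = cong₂ _*_ (cong f (sym (+-suc p u)))
    (trans (cong (𝟙 ∘ (p ∣?_)) (sym (+-suc p u)))
           (𝟙-cong (p ∣? p + suc u) (p ∣? suc u) (λ d → ∣m+n∣m⇒∣n d ∣-refl) (∣m∣n⇒∣m+n ∣-refl)))

coprime-∣ʳ : Coprime m n → o ∣ n → Coprime m o
coprime-∣ʳ c o∣n (d∣m , d∣o) = c (d∣m , ∣-trans d∣o o∣n)

coprime-∣ˡ : Coprime m n → o ∣ m → Coprime o n
coprime-∣ˡ c o∣m = Coprime.sym (coprime-∣ʳ (Coprime.sym c) o∣m)

coprime-* : Coprime m n → Coprime m o → Coprime m (n * o)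
coprime-* c₁ c₂ (d∣m , d∣n*o) = c₂ (d∣m , coprime-divisor (coprime-∣ˡ c₁ d∣m) d∣n*o)

coprime-+⁻¹ : Coprime (n + m) n → Coprime m n
coprime-+⁻¹ c (d∣m , d∣n) = c (∣m∣n⇒∣m+n d∣n d∣m , d∣n)

coprime-1 : Coprime m 1
coprime-1 (_ , d∣1) = ∣1⇒≡1 d∣1

prime>1 : Prime p → 1 < p
prime>1 {p} pr = nonTrivial⇒n>1 p {{prime⇒nonTrivial pr}}

prime∤⇒coprime : Prime p → ¬ p ∣ m → Coprime p m
prime∤⇒coprime pr p∤m (d∣p , d∣m) with prime⇒irreducible pr d∣p
... | inj₁ d≡1 = d≡1
... | inj₂ refl = contradiction d∣m p∤m

coprime⇒prime∤ : Prime p → Coprime p m → ¬ p ∣ m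
coprime⇒prime∤ pr c p∣m = <⇒≢ (prime>1 pr) (sym (c (∣-refl , p∣m)))

primes-≢⇒coprime : Prime p → Prime o → p ≢ o → Coprime p o
primes-≢⇒coprime {p} pp po p≢o = prime∤⇒coprime pp p∤o
  where
  p∤o : ¬ p ∣ _
  p∤o p∣o with prime⇒irreducible po p∣o
  ... | inj₁ p≡1 = <⇒≢ (prime>1 pp) (sym p≡1)
  ... | inj₂ p≡o = p≢o p≡o

coprime-prodF : ∀ {k} (q : Fin k → ℕ) → (∀ i → Coprime m (q i)) → Coprime m (prodF q)
coprime-prodF {k = zero}  q c = coprime-1
coprime-prodF {k = suc k} q c = coprime-* (c Fin.zero) (coprime-prodF (tail q) (c ∘ Fin.suc))

length-filter-applyUpTo : {P : ℕ → Set} (P? : ∀ x → Dec (P x)) (f : ℕ → ℕ) (n : ℕ) →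
  length (filter P? (applyUpTo f n)) ≡ ∑< n (𝟙 ∘ P? ∘ f)
length-filter-applyUpTo P? f zero = refl
length-filter-applyUpTo P? f (suc n) with P? (f 0)
... | yes _ = cong suc (length-filter-applyUpTo P? (f ∘ suc) n)
... | no _  = length-filter-applyUpTo P? (f ∘ suc) n

χ : ℕ → ℕ → ℕ
χ n z = 𝟙 (gcd z n ≟ 1)

χ-cong : ∀ n z n′ z′ → (Coprime z n → Coprime z′ n′) → (Coprime z′ n′ → Coprime z n) → χ n z ≡ χ n′ z′
χ-cong n z n′ z′ to from = 𝟙-cong (gcd z n ≟ 1) (gcd z′ n′ ≟ 1)
  (coprime⇒gcd≡1 ∘ to ∘ gcd≡1⇒coprime) (coprime⇒gcd≡1 ∘ from ∘ gcd≡1⇒coprime)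

φ≡∑χ : ∀ n → φ n ≡ ∑< n (χ n ∘ suc)
φ≡∑χ n = trans (cong (length ∘ filter (λ z → gcd z n ≟ 1)) (map-upTo suc n))
               (length-filter-applyUpTo (λ z → gcd z n ≟ 1) suc n)

χ-periodic : ∀ n z → χ n (n + z) ≡ χ n z
χ-periodic n z = χ-cong n (n + z) n z coprime-+⁻¹ coprime-+

χ-split : Prime p → ∀ n z → χ n z ≡ χ (p * n) z + χ n z * 𝟙 (p ∣? z)
χ-split {p} pr n z with p ∣? z
... | yes p∣z = begin
  χ n z                 ≡⟨ sym (*-identityʳ (χ n z)) ⟩
  0 + χ n z * 1         ≡⟨ cong (_+ χ n z * 1) (sym (𝟙-no (gcd z (p * n) ≟ 1) (p∤z ∘ gcd≡1⇒coprime))) ⟩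
  χ (p * n) z + χ n z * 1 ∎
  where
  open ≡-Reasoning
  p∤z : ¬ Coprime z (p * n)
  p∤z c = coprime⇒prime∤ pr (Coprime.sym (coprime-∣ʳ c (m∣m*n n))) p∣z
... | no p∤z = begin
  χ n z
    ≡⟨ χ-cong n z (p * n) z (coprime-* (Coprime.sym (prime∤⇒coprime pr p∤z))) (λ c → coprime-∣ʳ c (n∣m*n p)) ⟩
  χ (p * n) z           ≡⟨ sym (+-identityʳ _) ⟩
  χ (p * n) z + 0       ≡⟨ cong (_+_ (χ (p * n) z)) (sym (*-zeroʳ (χ n z))) ⟩
  χ (p * n) z + χ n z * 0 ∎
  where open ≡-Reasoning

-- Of the z ≤ p * n, p * φ n are coprime to n (periodicity); they are the φ (p * n) coprime to
-- p * n together with the multiples p * w, w ≤ n, which are coprime to n exactly when w is.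
φ[p*n]+φ[n]≡p*φ[n] : Prime p → Coprime p n → φ (p * n) + φ n ≡ p * φ n
φ[p*n]+φ[n]≡p*φ[n] {p} {n} pr p⊥n = sym (begin
  p * φ n                                    ≡⟨ cong (p *_) (φ≡∑χ n) ⟩
  p * ∑< n (χ n ∘ suc)                        ≡⟨ sym (∑<-periodic n (χ n ∘ suc) periodic p) ⟩
  ∑< (p * n) (χ n ∘ suc)                      ≡⟨ ∑<-cong (p * n) (λ {u} _ → χ-split pr n (suc u)) ⟩
  ∑< (p * n) (λ u → χ (p * n) (suc u) + multiple u) ≡⟨ ∑<-distrib (p * n) (χ (p * n) ∘ suc) multiple ⟩
  ∑< (p * n) (χ (p * n) ∘ suc) + ∑< (p * n) multiple ≡⟨ cong₂ _+_ (sym (φ≡∑χ (p * n))) multiples ⟩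
  φ (p * n) + φ n                             ∎)
  where
  open ≡-Reasoning
  multiple : ℕ → ℕ
  multiple u = χ n (suc u) * 𝟙 (p ∣? suc u)
  periodic : ∀ u → χ n (suc (n + u)) ≡ χ n (suc u)
  periodic u = trans (cong (χ n) (sym (+-suc n u))) (χ-periodic n (suc u))
  multiples : ∑< (p * n) multiple ≡ φ n
  multiples = begin
    ∑< (p * n) multiple                ≡⟨ cong (λ l → ∑< l multiple) (*-comm p n) ⟩
    ∑< (n * p) multiple                ≡⟨ ∑<-multiples p {{prime⇒nonZero pr}} (χ n) n ⟩
    ∑< n (λ w → χ n (p * suc w))       ≡⟨ ∑<-cong n (λ {w} _ → χ-cong n (p * suc w) n (suc w)
                                            (λ c → coprime-∣ˡ c (n∣m*n p))
                                            (λ c → Coprime.sym (coprime-* (Coprime.sym p⊥n) (Coprime.sym c)))) ⟩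
    ∑< n (χ n ∘ suc)                   ≡⟨ sym (φ≡∑χ n) ⟩
    φ n                                ∎

φ-*-prime : Prime p → Coprime p n → φ (p * n) ≡ (p ∸ 1) * φ n
φ-*-prime {p} {n} pr p⊥n = begin
  φ (p * n)                ≡⟨ sym (m+n∸n≡m (φ (p * n)) (φ n)) ⟩
  φ (p * n) + φ n ∸ φ n    ≡⟨ cong (_∸ φ n) (φ[p*n]+φ[n]≡p*φ[n] pr p⊥n) ⟩
  p * φ n ∸ φ n            ≡⟨ cong (p * φ n ∸_) (sym (*-identityˡ (φ n))) ⟩
  p * φ n ∸ 1 * φ n        ≡⟨ sym (*-distribʳ-∸ (φ n) p 1) ⟩
  (p ∸ 1) * φ n            ∎
  where open ≡-Reasoning

strictlyIncreasing⇒injective : ∀ {k} {q : Fin k → ℕ} → (∀ i j → i Fin.< j → q i < q j) → Injective _≡_ _≡_ q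
strictlyIncreasing⇒injective increasing {i} {j} qi≡qj with Finₚ.<-cmp i j
... | tri< i<j _ _ = contradiction qi≡qj (<⇒≢ (increasing i j i<j))
... | tri≈ _ i≡j _ = i≡j
... | tri> _ _ j<i = contradiction (sym qi≡qj) (<⇒≢ (increasing j i j<i))

φ-prodF : ∀ {k} (q : Fin k → ℕ) → (∀ i → Prime (q i)) → Injective _≡_ _≡_ q →
  φ (prodF q) ≡ prodF (λ i → q i ∸ 1)
φ-prodF {k = zero}  q prime injective = refl
φ-prodF {k = suc k} q prime injective = begin
  φ (head q * prodF (tail q))
    ≡⟨ φ-*-prime (prime Fin.zero) head⊥tail ⟩
  (head q ∸ 1) * φ (prodF (tail q))
    ≡⟨ cong ((head q ∸ 1) *_) (φ-prodF (tail q) (prime ∘ Fin.suc) (Finₚ.suc-injective ∘ injective)) ⟩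
  (head q ∸ 1) * prodF (λ i → tail q i ∸ 1) ∎
  where
  open ≡-Reasoning
  head⊥tail : Coprime (head q) (prodF (tail q))
  head⊥tail = coprime-prodF (tail q) (λ i →
    primes-≢⇒coprime (prime Fin.zero) (prime (Fin.suc i)) (λ eq → Finₚ.0≢1+n (injective eq)))

q²y≤[q∸1]²[y+4] : ∀ q y → y + 3 ≤ 2 * q → q * q * y ≤ (q ∸ 1) * (q ∸ 1) * (y + 4)
q²y≤[q∸1]²[y+4] zero    y y+3≤0  = contradiction (subst (_≤ 0) (+-comm y 3) y+3≤0) λ ()
q²y≤[q∸1]²[y+4] (suc t) y y+3≤2q = begin
  suc t * suc t * y               ≡⟨ expand t y ⟩
  t * t * y + (2 * t + 1) * y     ≤⟨ +-monoʳ-≤ (t * t * y) (+-cancelʳ-≤ (2 * t + 1) _ _ cross) ⟩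
  t * t * y + 4 * t * t           ≡⟨ collect t y ⟩
  t * t * (y + 4)                 ∎
  where
  open ≤-Reasoning
  expand : ∀ t y → suc t * suc t * y ≡ t * t * y + (2 * t + 1) * y
  expand = solve-∀
  collect : ∀ t y → t * t * y + 4 * t * t ≡ t * t * (y + 4)
  collect = solve-∀
  distrib : ∀ t y → (2 * t + 1) * y + (2 * t + 1) ≡ (2 * t + 1) * (y + 1)
  distrib = solve-∀
  square : ∀ t → (2 * t + 1) * (2 * t) ≡ 4 * t * t + 2 * t
  square = solve-∀
  double-suc : ∀ t → 2 * suc t ≡ 2 * t + 2
  double-suc = solve-∀
  y+1≤2t : y + 1 ≤ 2 * t
  y+1≤2t = +-cancelʳ-≤ 2 (y + 1) (2 * t) (subst₂ _≤_ (sym (+-assoc y 1 2)) (double-suc t) y+3≤2q)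
  cross : (2 * t + 1) * y + (2 * t + 1) ≤ 4 * t * t + (2 * t + 1)
  cross = begin
    (2 * t + 1) * y + (2 * t + 1) ≡⟨ distrib t y ⟩
    (2 * t + 1) * (y + 1)         ≤⟨ *-monoʳ-≤ (2 * t + 1) y+1≤2t ⟩
    (2 * t + 1) * (2 * t)         ≡⟨ square t ⟩
    4 * t * t + 2 * t             ≤⟨ +-monoʳ-≤ (4 * t * t) (m≤m+n (2 * t) 1) ⟩
    4 * t * t + (2 * t + 1)       ∎

prodF²-ratio : ∀ {n} (q : Fin n → ℕ) y → (∀ i → y + 3 ≤ 2 * q i) → (∀ i j → i Fin.< j → q i + 2 ≤ q j) →
  prodF q * prodF q * y ≤ prodF (λ i → q i ∸ 1) * prodF (λ i → q i ∸ 1) * (y + 4 * n)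
prodF²-ratio {zero}  q y _ _ = ≤-reflexive (cong (1 * 1 *_) (sym (+-identityʳ y)))
prodF²-ratio {suc n} q y y+3≤2q gap = begin
  (A * M) * (A * M) * y              ≡⟨ regroup A M y ⟩
  (A * A * y) * (M * M)              ≤⟨ *-monoˡ-≤ (M * M) (q²y≤[q∸1]²[y+4] A y (y+3≤2q Fin.zero)) ⟩
  (B * B * (y + 4)) * (M * M)        ≡⟨ regroup′ B M (y + 4) ⟩
  (B * B) * (M * M * (y + 4))        ≤⟨ *-monoʳ-≤ (B * B) (prodF²-ratio (tail q) (y + 4) y+7≤2q gap′) ⟩
  (B * B) * (F * F * (y + 4 + 4 * n)) ≡⟨ regroup″ B F y n ⟩
  (B * F) * (B * F) * (y + 4 * suc n) ∎
  where
  open ≤-Reasoning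
  A = head q
  B = head q ∸ 1
  M = prodF (tail q)
  F = prodF (λ i → tail q i ∸ 1)
  regroup : ∀ a b c → (a * b) * (a * b) * c ≡ (a * a * c) * (b * b)
  regroup = solve-∀
  regroup′ : ∀ a b c → (a * a * c) * (b * b) ≡ (a * a) * (b * b * c)
  regroup′ = solve-∀
  regroup″ : ∀ a b y n → (a * a) * (b * b * (y + 4 + 4 * n)) ≡ (a * b) * (a * b) * (y + 4 * suc n)
  regroup″ = solve-∀
  gap′ : ∀ i j → i Fin.< j → tail q i + 2 ≤ tail q j
  gap′ i j i<j = gap (Fin.suc i) (Fin.suc j) (s<s i<j)
  y+7≤2q : ∀ i → y + 4 + 3 ≤ 2 * tail q i
  y+7≤2q i = begin
    y + 4 + 3        ≡⟨ trans (+-assoc y 4 3) (sym (+-assoc y 3 4)) ⟩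
    y + 3 + 4        ≤⟨ +-monoˡ-≤ 4 (y+3≤2q Fin.zero) ⟩
    2 * A + 4        ≡⟨ sym (*-distribˡ-+ 2 A 2) ⟩
    2 * (A + 2)      ≤⟨ *-monoʳ-≤ 2 (gap Fin.zero (Fin.suc i) z<s) ⟩
    2 * tail q i     ∎

a²[y+4j]≤[1+a]²y : ∀ a j y → 1 ≤ a → 2 ≤ j → 2 * j * a ≤ y + 1 → a * a * (y + 4 * j) ≤ suc a * suc a * y
a²[y+4j]≤[1+a]²y a j y 1≤a 2≤j 2ja≤y+1 = begin
  a * a * (y + 4 * j)              ≡⟨ expand a y j ⟩
  a * a * y + 4 * j * a * a        ≤⟨ +-monoʳ-≤ (a * a * y) (+-cancelʳ-≤ (2 * a + 1) _ _ cross) ⟩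
  a * a * y + (2 * a + 1) * y      ≡⟨ collect a y ⟩
  suc a * suc a * y                ∎
  where
  open ≤-Reasoning
  expand : ∀ a y j → a * a * (y + 4 * j) ≡ a * a * y + 4 * j * a * a
  expand = solve-∀
  collect : ∀ a y → a * a * y + (2 * a + 1) * y ≡ suc a * suc a * y
  collect = solve-∀
  distrib : ∀ a j → 4 * j * a * a + 2 * j * a ≡ (2 * a + 1) * (2 * j * a)
  distrib = solve-∀
  distrib′ : ∀ a y → (2 * a + 1) * (y + 1) ≡ (2 * a + 1) * y + (2 * a + 1)
  distrib′ = solve-∀
  double : ∀ a → 2 * a + 2 * a ≡ 2 * 2 * a
  double = solve-∀
  2a+1≤2ja : 2 * a + 1 ≤ 2 * j * a
  2a+1≤2ja = begin
    2 * a + 1      ≤⟨ +-monoʳ-≤ (2 * a) (≤-trans 1≤a (m≤m+n a (a + 0))) ⟩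
    2 * a + 2 * a  ≡⟨ double a ⟩
    2 * 2 * a      ≤⟨ *-monoˡ-≤ a (*-monoʳ-≤ 2 2≤j) ⟩
    2 * j * a      ∎
  cross : 4 * j * a * a + (2 * a + 1) ≤ (2 * a + 1) * y + (2 * a + 1)
  cross = begin
    4 * j * a * a + (2 * a + 1)     ≤⟨ +-monoʳ-≤ (4 * j * a * a) 2a+1≤2ja ⟩
    4 * j * a * a + 2 * j * a       ≡⟨ distrib a j ⟩
    (2 * a + 1) * (2 * j * a)       ≤⟨ *-monoʳ-≤ (2 * a + 1) 2ja≤y+1 ⟩
    (2 * a + 1) * (y + 1)           ≡⟨ distrib′ a y ⟩
    (2 * a + 1) * y + (2 * a + 1)   ∎

m*m≤n*n⇒m≤n : m * m ≤ n * n → m ≤ n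
m*m≤n*n⇒m≤n {m} {n} m²≤n² with m ≤? n
... | yes m≤n = m≤n
... | no  m≰n = contradiction m²≤n² (<⇒≱ (*-mono-< (≰⇒> m≰n) (≰⇒> m≰n)))

-- (M / F)² ≤ w / y ≤ (b / a)² gives M / F ≤ b / a, multiplied out.
ratio-≤-via-squares : ∀ M F a b y w .{{_ : NonZero y}} →
  M * M * y ≤ F * F * w → a * a * w ≤ b * b * y → a * M ≤ b * F
ratio-≤-via-squares M F a b y w M²y≤F²w a²w≤b²y = m*m≤n*n⇒m≤n (*-cancelʳ-≤ _ _ y (begin
  (a * M) * (a * M) * y    ≡⟨ regroup a M y ⟩
  (a * a) * (M * M * y)    ≤⟨ *-monoʳ-≤ (a * a) M²y≤F²w ⟩
  (a * a) * (F * F * w)    ≡⟨ regroup′ a F w ⟩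
  (F * F) * (a * a * w)    ≤⟨ *-monoʳ-≤ (F * F) a²w≤b²y ⟩
  (F * F) * (b * b * y)    ≡⟨ regroup″ F b y ⟩
  (b * F) * (b * F) * y    ∎))
  where
  open ≤-Reasoning
  regroup : ∀ a M y → (a * M) * (a * M) * y ≡ (a * a) * (M * M * y)
  regroup = solve-∀
  regroup′ : ∀ a F w → (a * a) * (F * F * w) ≡ (F * F) * (a * a * w)
  regroup′ = solve-∀
  regroup″ : ∀ F b y → (F * F) * (b * b * y) ≡ (b * F) * (b * F) * y
  regroup″ = solve-∀

a<q⇒aq≤[1+a][q∸1] : ∀ a q → a < q → a * q ≤ suc a * (q ∸ 1)
a<q⇒aq≤[1+a][q∸1] a (suc t) (s≤s a≤t) = subst (_≤ suc a * t) (sym (*-suc a t)) (+-monoˡ-≤ (a * t) a≤t)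

2∣n⊎2∣1+n : ∀ n → 2 ∣ n ⊎ 2 ∣ suc n
2∣n⊎2∣1+n zero    = inj₁ (divides 0 refl)
2∣n⊎2∣1+n (suc n) with 2∣n⊎2∣1+n n
... | inj₁ 2∣n   = inj₂ (∣m∣n⇒∣m+n ∣-refl 2∣n)
... | inj₂ 2∣1+n = inj₁ 2∣1+n

odd<odd⇒+2≤ : ¬ 2 ∣ m → ¬ 2 ∣ n → m < n → m + 2 ≤ n
odd<odd⇒+2≤ {m} {n} m-odd n-odd m<n with m≤n⇒m<n∨m≡n m<n
... | inj₁ 1+m<n = subst (_≤ n) (+-comm 2 m) 1+m<n
... | inj₂ refl with 2∣n⊎2∣1+n m
...   | inj₁ 2∣m   = contradiction 2∣m m-odd
...   | inj₂ 2∣1+m = contradiction 2∣1+m n-odd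

prodF-ratio-bound : ∀ {n} (q : Fin (suc n) → ℕ) a → (∀ i → ¬ 2 ∣ q i) → (∀ i j → i Fin.< j → q i < q j) →
  suc n * a < head q → a * prodF q ≤ suc a * prodF (λ i → q i ∸ 1)
prodF-ratio-bound q zero _ _ _ = z≤n
-- A single factor is handled directly: squaring loses too much there.
prodF-ratio-bound {zero} q a@(suc _) _ _ a<q =
  subst₂ (λ u v → a * u ≤ suc a * v) (sym (*-identityʳ (head q))) (sym (*-identityʳ (head q ∸ 1)))
    (a<q⇒aq≤[1+a][q∸1] a (head q) (subst (_< head q) (*-identityˡ a) a<q))
prodF-ratio-bound {suc n} q a@(suc _) odd increasing ja<q =
  ratio-≤-via-squares (prodF q) (prodF (λ i → q i ∸ 1)) a (suc a) y (y + 4 * j) {{>-nonZero 0<y}}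
    (prodF²-ratio q y y+3≤2q (λ i j i<j → odd<odd⇒+2≤ (odd i) (odd j) (increasing i j i<j)))
    (a²[y+4j]≤[1+a]²y a j y (s≤s z≤n) (s≤s (s≤s z≤n)) 2ja≤y+1)
  where
  j = suc (suc n)
  y = 2 * head q ∸ 3
  y+3≡2q : y + 3 ≡ 2 * head q
  y+3≡2q = m∸n+n≡m (≤-trans (s≤s (s≤s (s≤s z≤n))) (*-monoʳ-≤ 2 (≤-trans (s≤s (s≤s z≤n)) ja<q)))
  y+3≤2q : ∀ i → y + 3 ≤ 2 * q i
  y+3≤2q Fin.zero    = ≤-reflexive y+3≡2q
  y+3≤2q (Fin.suc i) = subst (_≤ 2 * q (Fin.suc i)) (sym y+3≡2q) (*-monoʳ-≤ 2 (<⇒≤ (increasing Fin.zero (Fin.suc i) z<s)))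
  double-suc : ∀ m → 2 * m + 2 ≡ 2 * suc m
  double-suc = solve-∀
  2ja≤y+1 : 2 * j * a ≤ y + 1
  2ja≤y+1 = +-cancelʳ-≤ 2 (2 * j * a) (y + 1) (begin
    2 * j * a + 2       ≡⟨ cong (_+ 2) (*-assoc 2 j a) ⟩
    2 * (j * a) + 2     ≡⟨ double-suc (j * a) ⟩
    2 * suc (j * a)     ≤⟨ *-monoʳ-≤ 2 ja<q ⟩
    2 * head q          ≡⟨ sym y+3≡2q ⟩
    y + 3               ≡⟨ sym (+-assoc y 1 2) ⟩
    y + 1 + 2           ∎)
    where open ≤-Reasoning
  0<y : 0 < y
  0<y = +-cancelʳ-< 1 0 y (≤-trans 2≤2ja 2ja≤y+1)
    where
    2≤2ja : 2 ≤ 2 * j * a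
    2≤2ja = *-mono-≤ {2 * 1} {2 * j} {1} {a} (*-monoʳ-≤ 2 {1} {j} (s≤s z≤n)) (s≤s z≤n)

2[pM∸[p∸1]F]≤3M : ∀ p M F → 3 ≤ p → (2 * p ∸ 3) * M ≤ suc (2 * p ∸ 3) * F → 2 * (p * M ∸ (p ∸ 1) * F) ≤ 3 * M
2[pM∸[p∸1]F]≤3M p M F 3≤p aM≤[1+a]F = begin
  2 * (p * M ∸ (p ∸ 1) * F)         ≡⟨ *-distribˡ-∸ 2 (p * M) ((p ∸ 1) * F) ⟩
  2 * (p * M) ∸ 2 * ((p ∸ 1) * F)   ≤⟨ m≤n+o⇒m∸n≤o (2 * (p * M)) (2 * ((p ∸ 1) * F)) (begin
    2 * (p * M)                       ≡⟨ sym (*-assoc 2 p M) ⟩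
    2 * p * M                         ≡⟨ cong (_* M) (sym a+3≡2p) ⟩
    (a + 3) * M                       ≡⟨ *-distribʳ-+ M a 3 ⟩
    a * M + 3 * M                     ≤⟨ +-monoˡ-≤ (3 * M) aM≤[1+a]F ⟩
    suc a * F + 3 * M                 ≡⟨ cong (λ c → c * F + 3 * M) (1+a≡2[p∸1] p 3≤p) ⟩
    2 * (p ∸ 1) * F + 3 * M           ≡⟨ cong (_+ 3 * M) (*-assoc 2 (p ∸ 1) F) ⟩
    2 * ((p ∸ 1) * F) + 3 * M         ∎) ⟩
  3 * M                             ∎
  where
  open ≤-Reasoning
  a = 2 * p ∸ 3
  a+3≡2p : a + 3 ≡ 2 * p
  a+3≡2p = m∸n+n≡m (≤-trans 3≤p (m≤m+n p (p + 0)))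
  1+a≡2[p∸1] : ∀ p → 3 ≤ p → suc (2 * p ∸ 3) ≡ 2 * (p ∸ 1)
  1+a≡2[p∸1] (suc (suc (suc r))) (s≤s (s≤s (s≤s _))) = cong suc (+-suc r _)

M≤2[2M∸ψ] : ∀ M ψ → 2 * ψ ≤ 3 * M → M ≤ 2 * (2 * M ∸ ψ)
M≤2[2M∸ψ] M ψ 2ψ≤3M = begin
  M                        ≡⟨ sym (m+n∸n≡m M (3 * M)) ⟩
  M + 3 * M ∸ 3 * M        ≡⟨ cong (_∸ 3 * M) (quadruple M) ⟩
  2 * (2 * M) ∸ 3 * M      ≤⟨ ∸-monoʳ-≤ (2 * (2 * M)) 2ψ≤3M ⟩
  2 * (2 * M) ∸ 2 * ψ      ≡⟨ sym (*-distribˡ-∸ 2 (2 * M) ψ) ⟩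
  2 * (2 * M ∸ ψ)          ∎
  where
  open ≤-Reasoning
  quadruple : ∀ M → M + 3 * M ≡ 2 * (2 * M)
  quadruple = solve-∀

δ⁻-bound : ∀ p M .{{_ : NonZero p}} → 2 * ψ (p * M) ≤ 3 * M → (+ 2) ℤ.* δ⁻ (p * M) p ℤ.≥ + (p * M / p)
δ⁻-bound p M 2ψ≤3M = subst (λ m → (+ 2) ℤ.* ((+ (2 * m)) ℤ.- (+ ψ′)) ℤ.≥ + m) (sym p*M/p≡M)
  (subst (+ M ℤ.≤_) (sym 2δ⁻≡) (+≤+ (M≤2[2M∸ψ] M ψ′ 2ψ≤3M)))
  where
  ψ′ = ψ (p * M)
  p*M/p≡M : p * M / p ≡ M
  p*M/p≡M = trans (cong (_/ p) (*-comm p M)) (m*n/n≡m M p)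
  ψ≤2M : ψ′ ≤ 2 * M
  ψ≤2M = *-cancelˡ-≤ 2 (≤-trans 2ψ≤3M (≤-trans (*-monoˡ-≤ M (n≤1+n 3)) (≤-reflexive (*-assoc 2 2 M))))
  2δ⁻≡ : (+ 2) ℤ.* ((+ (2 * M)) ℤ.- (+ ψ′)) ≡ + (2 * (2 * M ∸ ψ′))
  2δ⁻≡ = trans (cong ((+ 2) ℤ.*_) (trans (ℤₚ.m-n≡m⊖n (2 * M) ψ′) (ℤₚ.⊖-≥ ψ≤2M))) (sym (ℤₚ.pos-* 2 (2 * M ∸ ψ′)))

mainTheorem14 : (k : ℕ) (hk : 2 ≤ k) (p : Fin k → ℕ)
    → (pr : ∀ i → Prime (p i))
    → (∀ i → ¬ (2 ∣ p i))
    → (∀ i j → i Fin.< j → p i < p j)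
    → (k ∸ 1) * (2 * p (i₁ hk) ∸ 3) < p (i₂ hk)
    → (+ 2) ℤ.* δ⁻ (prodF p) (p (i₁ hk)) {{prime⇒nonZero (pr (i₁ hk))}}
        ℤ.≥ + (_/_ (prodF p) (p (i₁ hk)) {{prime⇒nonZero (pr (i₁ hk))}})
-- Matching hk makes i₁ hk and i₂ hk compute to 0 and 1.
mainTheorem14 (suc (suc k)) (s≤s (s≤s z≤n)) p prime odd increasing k-1*a<p₂ =
  δ⁻-bound (head p) M {{prime⇒nonZero (prime Fin.zero)}}
    (subst (λ φn → 2 * (prodF p ∸ φn) ≤ 3 * M) (sym φ≡) 2ψ≤3M)
  where
  M = prodF (tail p)
  F = prodF (λ i → tail p i ∸ 1)
  φ≡ : φ (prodF p) ≡ (head p ∸ 1) * F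
  φ≡ = φ-prodF p prime (strictlyIncreasing⇒injective increasing)
  3≤p₁ : 3 ≤ head p
  3≤p₁ = ≤∧≢⇒< (prime>1 (prime Fin.zero)) (λ 2≡p₁ → odd Fin.zero (subst (2 ∣_) 2≡p₁ ∣-refl))
  aM≤[1+a]F : (2 * head p ∸ 3) * M ≤ suc (2 * head p ∸ 3) * F
  aM≤[1+a]F = prodF-ratio-bound (tail p) (2 * head p ∸ 3) (odd ∘ Fin.suc)
    (λ i j i<j → increasing (Fin.suc i) (Fin.suc j) (s<s i<j)) k-1*a<p₂
  2ψ≤3M : 2 * (head p * M ∸ (head p ∸ 1) * F) ≤ 3 * M
  2ψ≤3M = 2[pM∸[p∸1]F]≤3M (head p) M F 3≤p₁ aM≤[1+a]F
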